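{- Let $w_{1},w_{2}$ be any odd positive integers and $n\ge0$ an integer. Then \[ \sum_{k=0}^{n}\binom{n}{k}T_{k}(w_{2}-1)T_{n-k}(w_{1}-1)w_{1}^{k} =\sum_{k=0}^{n}\binom{n}{k}T_{k}(w_{1}-1)T_{n-k}(w_{2}-1)w_{2}^{k}. \]
   Context: For integers $k,N\ge0$, $T_{k}(N)=\sum_{i=0}^{N}(-1)^{i}i^{k}$, with the convention $0^0=1$. -}

module Defs where

open import Data.Nat as ℕ using (ℕ; zero; suc)
open import Data.Nat.Combinatorics using (_C_)
open import Data.Integer as ℤ using (ℤ; +_)
open import Data.Product using (Σ)
open import Relation.Binary.PropositionalEquality using (_≡_)

sgn : ℕ → ℤ
sgn zero = + 1
sgn (suc i) = ℤ.- sgn i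

-- T k N = Σ_{i=0}^{N} (-1)^i i^k, with 0^0 = 1 (ℕ's _^_ has 0 ^ 0 = 1)
T : ℕ → ℕ → ℤ
T k zero = + (0 ℕ.^ k)
T k (suc N) = T k N ℤ.+ sgn (suc N) ℤ.* + (suc N ℕ.^ k)

sumTo : ℕ → (ℕ → ℤ) → ℤ
sumTo zero f = f 0
sumTo (suc n) f = sumTo n f ℤ.+ f (suc n)

OddPos : ℕ → Set
OddPos w = Σ ℕ (λ m → w ≡ suc (2 ℕ.* m))

module Submission where

-- Write a = w₁ and b = w₂, both odd, and let
--   A n M = Σ_{x<M} (-1)^x x^n   (below: sum< M (altPow n)),
-- so that T k (N ∸ 1) = A k N for N ≥ 1.
-- Every x < a·b is uniquely x = a·i + j with i < b and j < a, and because a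
-- is odd, (-1)^(a·i+j) = (-1)^i (-1)^j.  Expanding (a·i + j)^n binomially gives
--   (-1)^x x^n = Σ_k C(n,k) ((-1)^i i^k) ((-1)^j j^(n-k)) a^k,
-- and summing over i < b, j < a (then exchanging the finite sums) yields
--   Σ_k C(n,k) T_k(b-1) T_{n-k}(a-1) a^k = A n (a·b).
-- The right-hand side is symmetric in a and b, which is the corollary.

open import Defs
open import Data.Nat as ℕ using (ℕ; zero; suc; _∸_)
open import Data.Nat.Combinatorics using (_C_)
open import Data.Integer as ℤ using (ℤ; +_; _+_; _*_; -_)
open import Data.Fin using (toℕ)
open import Data.Product using (_,_)
open import Function using (_∘_)
open import Relation.Binary.PropositionalEquality
import Data.Nat.Properties as ℕP
import Data.Integer.Properties as ℤP
open import Data.Integer.Solver using (module +-*-Solver)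
import Algebra.Properties.CommutativeSemiring.Binomial as Binomial
import Algebra.Properties.Monoid.Sum as MonoidSum
import Algebra.Definitions.RawSemiring as RawSemiringDefs

open ≡-Reasoning

sum< : ℕ → (ℕ → ℤ) → ℤ
sum< zero    f = + 0
sum< (suc n) f = sum< n f + f n

sum<-cong : ∀ n {f g : ℕ → ℤ} → (∀ i → f i ≡ g i) → sum< n f ≡ sum< n g
sum<-cong zero    f≗g = refl
sum<-cong (suc n) f≗g = cong₂ _+_ (sum<-cong n f≗g) (f≗g n)

sum<-zero : ∀ n → sum< n (λ _ → + 0) ≡ + 0
sum<-zero zero    = refl
sum<-zero (suc n) = cong (_+ + 0) (sum<-zero n)

sum<-+ : ∀ n (f g : ℕ → ℤ) → sum< n (λ i → f i + g i) ≡ sum< n f + sum< n g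
sum<-+ zero    f g = refl
sum<-+ (suc n) f g =
  trans (cong (_+ (f n + g n)) (sum<-+ n f g)) (interchange (sum< n f) (sum< n g) (f n) (g n))
  where
  open +-*-Solver
  interchange : ∀ a b c d → a + b + (c + d) ≡ a + c + (b + d)
  interchange = solve 4 (λ a b c d → a :+ b :+ (c :+ d) := a :+ c :+ (b :+ d)) refl

sum<-*ˡ : ∀ n c (f : ℕ → ℤ) → sum< n (λ i → c * f i) ≡ c * sum< n f
sum<-*ˡ zero    c f = sym (ℤP.*-zeroʳ c)
sum<-*ˡ (suc n) c f =
  trans (cong (_+ c * f n) (sum<-*ˡ n c f)) (sym (ℤP.*-distribˡ-+ c (sum< n f) (f n)))

sum<-*ʳ : ∀ n c (f : ℕ → ℤ) → sum< n (λ i → f i * c) ≡ sum< n f * c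
sum<-*ʳ n c f = begin
  sum< n (λ i → f i * c) ≡⟨ sum<-cong n (λ i → ℤP.*-comm (f i) c) ⟩
  sum< n (λ i → c * f i) ≡⟨ sum<-*ˡ n c f ⟩
  c * sum< n f           ≡⟨ ℤP.*-comm c (sum< n f) ⟩
  sum< n f * c           ∎

sum<-swap : ∀ n m (f : ℕ → ℕ → ℤ) →
  sum< n (λ i → sum< m (f i)) ≡ sum< m (λ j → sum< n (λ i → f i j))
sum<-swap zero    m f = sym (sum<-zero m)
sum<-swap (suc n) m f =
  trans (cong (_+ sum< m (f n)) (sum<-swap n m f))
        (sym (sum<-+ m (λ j → sum< n (λ i → f i j)) (f n)))

sum<-split : ∀ a b (f : ℕ → ℤ) → sum< (a ℕ.+ b) f ≡ sum< a f + sum< b (λ j → f (a ℕ.+ j))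
sum<-split a zero    f rewrite ℕP.+-identityʳ a = sym (ℤP.+-identityʳ (sum< a f))
sum<-split a (suc b) f rewrite ℕP.+-suc a b =
  trans (cong (_+ f (a ℕ.+ b)) (sum<-split a b f)) (ℤP.+-assoc (sum< a f) _ _)

-- Peeling off the first term; this matches the recursion of Fin-indexed sums.
sum<-front : ∀ n (f : ℕ → ℤ) → sum< (suc n) f ≡ f 0 + sum< n (f ∘ suc)
sum<-front n f = trans (sum<-split 1 n f) (cong (_+ sum< n (f ∘ suc)) (ℤP.+-identityˡ (f 0)))

-- Euclidean division: x < a·p is uniquely a·i + j with i < p and j < a.
sum<-blocks : ∀ a p (f : ℕ → ℤ) →
  sum< p (λ i → sum< a (λ j → f (a ℕ.* i ℕ.+ j))) ≡ sum< (a ℕ.* p) f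
sum<-blocks a zero    f rewrite ℕP.*-zeroʳ a = refl
sum<-blocks a (suc p) f rewrite ℕP.*-suc a p | ℕP.+-comm a (a ℕ.* p) =
  trans (cong (_+ sum< a (λ j → f (a ℕ.* p ℕ.+ j))) (sum<-blocks a p f))
        (sym (sum<-split (a ℕ.* p) a f))

sum<-product : ∀ p q c d (F G : ℕ → ℤ) →
  c * sum< p F * sum< q G * d ≡ sum< p (λ i → sum< q (λ j → c * F i * G j * d))
sum<-product p q c d F G = begin
  c * sum< p F * sum< q G * d
    ≡⟨ cong (λ s → s * sum< q G * d) (sym (sum<-*ˡ p c F)) ⟩
  sum< p (λ i → c * F i) * sum< q G * d
    ≡⟨ cong (_* d) (sym (sum<-*ʳ p (sum< q G) (λ i → c * F i))) ⟩
  sum< p (λ i → c * F i * sum< q G) * d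
    ≡⟨ sym (sum<-*ʳ p d (λ i → c * F i * sum< q G)) ⟩
  sum< p (λ i → c * F i * sum< q G * d)
    ≡⟨ sum<-cong p (λ i → trans (cong (_* d) (sym (sum<-*ˡ q (c * F i) G)))
                                (sym (sum<-*ʳ q d (λ j → c * F i * G j)))) ⟩
  sum< p (λ i → sum< q (λ j → c * F i * G j * d)) ∎

sumTo≡sum< : ∀ n (g : ℕ → ℤ) → sumTo n g ≡ sum< (suc n) g
sumTo≡sum< zero    g = sym (ℤP.+-identityˡ (g 0))
sumTo≡sum< (suc n) g = cong (_+ g (suc n)) (sumTo≡sum< n g)

module ℕSemiring where
  open import Algebra.Bundles using (CommutativeSemiring)
  open CommutativeSemiring ℕP.+-*-commutativeSemiring public
    using (+-monoid; rawSemiring)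
  open RawSemiringDefs rawSemiring public using () renaming (_×_ to _×′_; _^_ to _^′_)
  open MonoidSum +-monoid public using (sum; sum-cong-≗)
  open import Algebra.Properties.CommutativeSemiring.Exp ℕP.+-*-commutativeSemiring
    using (^-distrib-*)

  ×′≡* : ∀ n x → n ×′ x ≡ n ℕ.* x
  ×′≡* zero    x = refl
  ×′≡* (suc n) x = cong (x ℕ.+_) (×′≡* n x)

  ^′≡^ : ∀ x n → x ^′ n ≡ x ℕ.^ n
  ^′≡^ x zero    = refl
  ^′≡^ x (suc n) = cong (x ℕ.*_) (^′≡^ x n)

  ^-distribʳ-* : ∀ x y n → (x ℕ.* y) ℕ.^ n ≡ x ℕ.^ n ℕ.* y ℕ.^ n
  ^-distribʳ-* x y n = begin
    (x ℕ.* y) ℕ.^ n        ≡⟨ sym (^′≡^ (x ℕ.* y) n) ⟩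
    (x ℕ.* y) ^′ n         ≡⟨ ^-distrib-* x y n ⟩
    x ^′ n ℕ.* y ^′ n      ≡⟨ cong₂ ℕ._*_ (^′≡^ x n) (^′≡^ y n) ⟩
    x ℕ.^ n ℕ.* y ℕ.^ n    ∎

  sum≡sum< : ∀ n (g : ℕ → ℕ) → + sum {n} (g ∘ toℕ) ≡ sum< n (λ k → + g k)
  sum≡sum< zero    g = refl
  sum≡sum< (suc n) g = begin
    + (g 0 ℕ.+ sum {n} (g ∘ suc ∘ toℕ))      ≡⟨ ℤP.pos-+ (g 0) _ ⟩
    + g 0 + + sum {n} (g ∘ suc ∘ toℕ)        ≡⟨ cong (_+_ (+ g 0)) (sum≡sum< n (g ∘ suc)) ⟩
    + g 0 + sum< n (λ k → + g (suc k))       ≡⟨ sym (sum<-front n (λ k → + g k)) ⟩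
    sum< (suc n) (λ k → + g k)               ∎

binomial : ∀ x y n →
  + ((x ℕ.+ y) ℕ.^ n) ≡ sum< (suc n) (λ k → + ((n C k) ℕ.* (x ℕ.^ k ℕ.* y ℕ.^ (n ∸ k))))
binomial x y n = begin
  + ((x ℕ.+ y) ℕ.^ n)
    ≡⟨ cong +_ (sym (^′≡^ (x ℕ.+ y) n)) ⟩
  + ((x ℕ.+ y) ^′ n)
    ≡⟨ cong +_ (Binomial.theorem ℕP.+-*-commutativeSemiring n x y) ⟩
  + sum {suc n} (λ k → (n C toℕ k) ×′ (x ^′ toℕ k ℕ.* y ^′ (n ∸ toℕ k)))
    ≡⟨ cong +_ (sum-cong-≗ {suc n} (λ k → term (toℕ k))) ⟩
  + sum {suc n} (λ k → (n C toℕ k) ℕ.* (x ℕ.^ toℕ k ℕ.* y ℕ.^ (n ∸ toℕ k)))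
    ≡⟨ sum≡sum< (suc n) (λ k → (n C k) ℕ.* (x ℕ.^ k ℕ.* y ℕ.^ (n ∸ k))) ⟩
  sum< (suc n) (λ k → + ((n C k) ℕ.* (x ℕ.^ k ℕ.* y ℕ.^ (n ∸ k)))) ∎
  where
  open ℕSemiring
  term : ∀ k → (n C k) ×′ (x ^′ k ℕ.* y ^′ (n ∸ k)) ≡ (n C k) ℕ.* (x ℕ.^ k ℕ.* y ℕ.^ (n ∸ k))
  term k = trans (×′≡* (n C k) _) (cong ((n C k) ℕ.*_) (cong₂ ℕ._*_ (^′≡^ x k) (^′≡^ y (n ∸ k))))

sgn-+ : ∀ x y → sgn (x ℕ.+ y) ≡ sgn x * sgn y
sgn-+ zero    y = sym (ℤP.*-identityˡ (sgn y))
sgn-+ (suc x) y = trans (cong -_ (sgn-+ x y)) (ℤP.neg-distribˡ-* (sgn x) (sgn y))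

sgn-square : ∀ x → sgn x * sgn x ≡ + 1
sgn-square zero    = refl
sgn-square (suc x) = trans (neg-square (sgn x)) (sgn-square x)
  where
  open +-*-Solver
  neg-square : ∀ s → - s * - s ≡ s * s
  neg-square = solve 1 (λ s → :- s :* :- s := s :* s) refl

sgn-even : ∀ y → sgn (2 ℕ.* y) ≡ + 1
sgn-even y = begin
  sgn (y ℕ.+ (y ℕ.+ 0))  ≡⟨ cong (λ z → sgn (y ℕ.+ z)) (ℕP.+-identityʳ y) ⟩
  sgn (y ℕ.+ y)          ≡⟨ sgn-+ y y ⟩
  sgn y * sgn y          ≡⟨ sgn-square y ⟩
  + 1                    ∎

sgn-odd-* : ∀ {a} → OddPos a → ∀ i → sgn (a ℕ.* i) ≡ sgn i
sgn-odd-* (m , refl) i = begin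
  sgn (i ℕ.+ 2 ℕ.* m ℕ.* i)     ≡⟨ cong (λ z → sgn (i ℕ.+ z)) (ℕP.*-assoc 2 m i) ⟩
  sgn (i ℕ.+ 2 ℕ.* (m ℕ.* i))   ≡⟨ sgn-+ i (2 ℕ.* (m ℕ.* i)) ⟩
  sgn i * sgn (2 ℕ.* (m ℕ.* i)) ≡⟨ cong (sgn i *_) (sgn-even (m ℕ.* i)) ⟩
  sgn i * + 1                   ≡⟨ ℤP.*-identityʳ (sgn i) ⟩
  sgn i                         ∎

altPow : ℕ → ℕ → ℤ
altPow k i = sgn i * + (i ℕ.^ k)

T≡sum< : ∀ k N → T k N ≡ sum< (suc N) (altPow k)
T≡sum< k zero    = sym (trans (ℤP.+-identityˡ _) (ℤP.*-identityˡ (+ (0 ℕ.^ k))))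
T≡sum< k (suc N) = cong (_+ altPow k (suc N)) (T≡sum< k N)

altPow-expand : ∀ {a} → OddPos a → ∀ n i j →
  sum< (suc n) (λ k → + (n C k) * altPow k i * altPow (n ∸ k) j * + (a ℕ.^ k))
    ≡ altPow n (a ℕ.* i ℕ.+ j)
altPow-expand {a} odd n i j = begin
  sum< (suc n) (λ k → + (n C k) * altPow k i * altPow (n ∸ k) j * + (a ℕ.^ k))
    ≡⟨ sum<-cong (suc n) term ⟩
  sum< (suc n) (λ k → sgn i * sgn j * + ((n C k) ℕ.* ((a ℕ.* i) ℕ.^ k ℕ.* j ℕ.^ (n ∸ k))))
    ≡⟨ sum<-*ˡ (suc n) (sgn i * sgn j) _ ⟩
  sgn i * sgn j * sum< (suc n) (λ k → + ((n C k) ℕ.* ((a ℕ.* i) ℕ.^ k ℕ.* j ℕ.^ (n ∸ k))))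
    ≡⟨ cong (sgn i * sgn j *_) (sym (binomial (a ℕ.* i) j n)) ⟩
  sgn i * sgn j * + ((a ℕ.* i ℕ.+ j) ℕ.^ n)
    ≡⟨ cong (_* + ((a ℕ.* i ℕ.+ j) ℕ.^ n)) sign ⟩
  altPow n (a ℕ.* i ℕ.+ j) ∎
  where
  sign : sgn i * sgn j ≡ sgn (a ℕ.* i ℕ.+ j)
  sign = sym (trans (sgn-+ (a ℕ.* i) j) (cong (_* sgn j) (sgn-odd-* odd i)))

  open +-*-Solver
  rearrange : ∀ c s ik t jk ak → c * (s * ik) * (t * jk) * ak ≡ s * t * (c * (ak * ik * jk))
  rearrange = solve 6 (λ c s ik t jk ak →
    c :* (s :* ik) :* (t :* jk) :* ak := s :* t :* (c :* (ak :* ik :* jk))) refl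

  embed : ∀ k → + ((n C k) ℕ.* ((a ℕ.* i) ℕ.^ k ℕ.* j ℕ.^ (n ∸ k)))
              ≡ + (n C k) * (+ (a ℕ.^ k) * + (i ℕ.^ k) * + (j ℕ.^ (n ∸ k)))
  embed k = begin
    + ((n C k) ℕ.* ((a ℕ.* i) ℕ.^ k ℕ.* j ℕ.^ (n ∸ k)))
      ≡⟨ ℤP.pos-* (n C k) _ ⟩
    + (n C k) * + ((a ℕ.* i) ℕ.^ k ℕ.* j ℕ.^ (n ∸ k))
      ≡⟨ cong (+ (n C k) *_) (ℤP.pos-* ((a ℕ.* i) ℕ.^ k) _) ⟩
    + (n C k) * (+ ((a ℕ.* i) ℕ.^ k) * + (j ℕ.^ (n ∸ k)))
      ≡⟨ cong (λ z → + (n C k) * (z * + (j ℕ.^ (n ∸ k))))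
              (trans (cong +_ (ℕSemiring.^-distribʳ-* a i k)) (ℤP.pos-* (a ℕ.^ k) (i ℕ.^ k))) ⟩
    + (n C k) * (+ (a ℕ.^ k) * + (i ℕ.^ k) * + (j ℕ.^ (n ∸ k))) ∎

  term : ∀ k → + (n C k) * altPow k i * altPow (n ∸ k) j * + (a ℕ.^ k)
             ≡ sgn i * sgn j * + ((n C k) ℕ.* ((a ℕ.* i) ℕ.^ k ℕ.* j ℕ.^ (n ∸ k)))
  term k = trans (rearrange (+ (n C k)) (sgn i) (+ (i ℕ.^ k)) (sgn j) (+ (j ℕ.^ (n ∸ k))) (+ (a ℕ.^ k)))
                 (cong (sgn i * sgn j *_) (sym (embed k)))

mixedSum≡altPowSum : ∀ {a} → OddPos a → ∀ n q →
  sumTo n (λ k → + (n C k) * T k q * T (n ∸ k) (a ∸ 1) * + (a ℕ.^ k))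
    ≡ sum< (a ℕ.* suc q) (altPow n)
mixedSum≡altPowSum {a} odd@(m , refl) n q = begin
  sumTo n (λ k → + (n C k) * T k q * T (n ∸ k) (2 ℕ.* m) * + (a ℕ.^ k))
    ≡⟨ sumTo≡sum< n _ ⟩
  sum< (suc n) (λ k → + (n C k) * T k q * T (n ∸ k) (2 ℕ.* m) * + (a ℕ.^ k))
    ≡⟨ sum<-cong (suc n) (λ k → cong₂ (λ s t → + (n C k) * s * t * + (a ℕ.^ k))
                                       (T≡sum< k q) (T≡sum< (n ∸ k) (2 ℕ.* m))) ⟩
  sum< (suc n) (λ k → + (n C k) * sum< (suc q) (altPow k) * sum< a (altPow (n ∸ k)) * + (a ℕ.^ k))
    ≡⟨ sum<-cong (suc n) (λ k → sum<-product (suc q) a (+ (n C k)) (+ (a ℕ.^ k)) (altPow k) (altPow (n ∸ k))) ⟩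
  sum< (suc n) (λ k → sum< (suc q) (λ i → sum< a (λ j → summand k i j)))
    ≡⟨ sum<-swap (suc n) (suc q) _ ⟩
  sum< (suc q) (λ i → sum< (suc n) (λ k → sum< a (summand k i)))
    ≡⟨ sum<-cong (suc q) (λ i → sum<-swap (suc n) a (λ k → summand k i)) ⟩
  sum< (suc q) (λ i → sum< a (λ j → sum< (suc n) (λ k → summand k i j)))
    ≡⟨ sum<-cong (suc q) (λ i → sum<-cong a (λ j → altPow-expand odd n i j)) ⟩
  sum< (suc q) (λ i → sum< a (λ j → altPow n (a ℕ.* i ℕ.+ j)))
    ≡⟨ sum<-blocks a (suc q) (altPow n) ⟩
  sum< (a ℕ.* suc q) (altPow n) ∎
  where
  summand : ℕ → ℕ → ℕ → ℤ
  summand k i j = + (n C k) * altPow k i * altPow (n ∸ k) j * + (a ℕ.^ k)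

-- Both sides equal Σ_{x<w₁·w₂} (-1)^x x^n, which is symmetric in w₁ and w₂.
corollary18 : (w₁ w₂ n : ℕ) → OddPos w₁ → OddPos w₂ →
    sumTo n (λ k → (+ (n C k)) ℤ.* T k (w₂ ∸ 1) ℤ.* T (n ∸ k) (w₁ ∸ 1) ℤ.* (+ (w₁ ℕ.^ k)))
      ≡ sumTo n (λ k → (+ (n C k)) ℤ.* T k (w₁ ∸ 1) ℤ.* T (n ∸ k) (w₂ ∸ 1) ℤ.* (+ (w₂ ℕ.^ k)))
corollary18 w₁ w₂ n odd₁@(m₁ , refl) odd₂@(m₂ , refl) = begin
  _ ≡⟨ mixedSum≡altPowSum odd₁ n (2 ℕ.* m₂) ⟩
  sum< (w₁ ℕ.* w₂) (altPow n) ≡⟨ cong (λ M → sum< M (altPow n)) (ℕP.*-comm w₁ w₂) ⟩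
  sum< (w₂ ℕ.* w₁) (altPow n) ≡⟨ sym (mixedSum≡altPowSum odd₂ n (2 ℕ.* m₁)) ⟩
  _ ∎
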